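{- Let $G$ be an undirected graph (possibly with loops and multiple edges), $w:V(G)\to\mathbb{N}$, and $R\subseteq V(G)$ such that $G\setminus R$ is a forest, $G[R]$ is a forest, and every vertex of $V(G)\setminus R$ is either a nice vertex or a tent. For each $v\in V(G)\setminus R$ label the edges incident to $v$ as $e^v_1,e^v_2$ if $v$ is nice, and as $e^v_0,e^v_1,e^v_2$ if $v$ is a tent (arbitrarily). Let $F=E(G[R])\cup\{e^v_0: v \text{ a tent}\}$, and let $H$ be the graph obtained from $G$ by contracting all edges of $F$, so that $E(H)=\bigcup_{v\in V(G)\setminus R}\{e^v_1,e^v_2\}$. Give the pair $\{e^v_1,e^v_2\}$ the weight $w_{\mathcal{M}}(\{e^v_1,e^v_2\})=w(v)$, and for $I\subseteq V(G)\setminus R$ write $w_{\mathcal{M}}(I)=\sum_{v\in I}w(v)$. Then for $I\subseteq V(G)\setminus R$, the set $\bigcup_{v\in I}\{e^v_1,e^v_2\}$ is an independent set of the graphic matroid $\mathcal{M}_H$ of maximum weight (among all sets of this form that are independent) if and only if $(V(G)\setminus R)\setminus I$ is a feedback vertex set of $G$ of minimum weight (among feedback vertex sets of $G$ contained in $V(G)\setminus R$).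
   Context: A vertex $v\in V(G)\setminus R$ is nice if $d_G(v)=2$ and both its neighbours lie in $R$; it is a tent if $d_G(v)=3$ and all its neighbours lie in $R$. A feedback vertex set of $G$ is a set $S$ with $G\setminus S$ a forest. The graphic matroid $\mathcal{M}_H$ has ground set $E(H)$, and a set of edges is independent iff it forms an acyclic subgraph (loops and parallel pairs are cycles). Contracting an edge $(u,v)$ merges $u,v$ into one vertex adjacent to all former neighbours of $u$ and $v$, the other edges being kept and identified with their images. -}

module Defs where

open import Data.Nat using (ℕ; zero; suc; _+_; _≤_)
open import Data.Nat.DivMod using (_%_; m%n<n)
open import Data.Fin using (Fin; toℕ; fromℕ<; _≟_)
open import Data.Fin.Subset using (Subset; _∈_; _∉_; _⊆_; ∁; _─_)
open import Data.Fin.Subset.Properties using (_∈?_)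
open import Data.Product using (Σ; _×_; _,_; proj₁; proj₂)
open import Data.Sum using (_⊎_)
open import Data.List using (List; tabulate; foldl)
open import Data.Nat.ListAction using (sum)
import Data.List.Membership.Propositional as ListMem
open import Data.Empty using (⊥)
open import Relation.Nullary using (¬_; yes; no)
open import Relation.Binary.PropositionalEquality using (_≡_; _≢_)
open import Function.Definitions using (Injective)
open import Function.Bundles using (_⇔_)

-- A finite multigraph (loops and parallel edges allowed) on vertex set Fin n,
-- with edge slots Fin m; edge e has endpoints  ends e.
Ends : ℕ → ℕ → Set
Ends n m = Fin m → Fin n × Fin n

Σfin : ∀ {k} → (Fin k → ℕ) → ℕ
Σfin f = sum (tabulate f)

next : ∀ {k} → Fin (suc k) → Fin (suc k)
next {k} i = fromℕ< (m%n<n (suc (toℕ i)) (suc k))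

Joins : ∀ {n m} → Ends n m → Fin m → Fin n → Fin n → Set
Joins ends e a b = ends e ≡ (a , b) ⊎ ends e ≡ (b , a)

-- A cycle (of length suc k) using only edges satisfying P:
-- distinct vertices v_0..v_k and distinct edges, edge i joins v_i and v_{i+1 mod (k+1)}.
-- Length 1 = a loop, length 2 = a pair of parallel edges.
record Cycle {n m} (ends : Ends n m) (P : Fin m → Set) : Set where
  field
    len : ℕ
    vs  : Fin (suc len) → Fin n
    es  : Fin (suc len) → Fin m
    vs-inj : Injective _≡_ _≡_ vs
    es-inj : Injective _≡_ _≡_ es
    es-in  : ∀ i → P (es i)
    joins  : ∀ i → Joins ends (es i) (vs i) (vs (next i))

Acyclic : ∀ {n m} → Ends n m → (Fin m → Set) → Set
Acyclic ends P = ¬ Cycle ends P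

EdgesAvoiding : ∀ {n m} → Ends n m → Subset n → Fin m → Set
EdgesAvoiding ends S e = proj₁ (ends e) ∉ S × proj₂ (ends e) ∉ S

EdgesInside : ∀ {n m} → Ends n m → Subset n → Fin m → Set
EdgesInside ends S e = proj₁ (ends e) ∈ S × proj₂ (ends e) ∈ S

IsFVS : ∀ {n m} → Ends n m → Subset n → Set
IsFVS ends S = Acyclic ends (EdgesAvoiding ends S)

-- incidence and degree (a loop contributes 2 to the degree)
Incident : ∀ {n m} → Ends n m → Fin m → Fin n → Set
Incident ends e v = proj₁ (ends e) ≡ v ⊎ proj₂ (ends e) ≡ v

indicator : ∀ {n} → Fin n → Fin n → ℕ
indicator a v with a ≟ v
... | yes _ = 1
... | no _ = 0

degree : ∀ {n m} → Ends n m → Fin n → ℕ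
degree ends v = Σfin (λ e → indicator (proj₁ (ends e)) v + indicator (proj₂ (ends e)) v)

-- all neighbours of v lie in R (a loop at v makes v its own neighbour)
NeighboursIn : ∀ {n m} → Ends n m → Subset n → Fin n → Set
NeighboursIn ends R v = ∀ e → (proj₁ (ends e) ≡ v → proj₂ (ends e) ∈ R)
                            × (proj₂ (ends e) ≡ v → proj₁ (ends e) ∈ R)

Nice : ∀ {n m} → Ends n m → Subset n → Fin n → Set
Nice ends R v = v ∉ R × degree ends v ≡ 2 × NeighboursIn ends R v

Tent : ∀ {n m} → Ends n m → Subset n → Fin n → Set
Tent ends R v = v ∉ R × degree ends v ≡ 3 × NeighboursIn ends R v

weight : ∀ {n} → (Fin n → ℕ) → Subset n → ℕ
weight w S = Σfin (λ v → sel v)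
  where
  sel : _ → ℕ
  sel v with v ∈? S
  ... | yes _ = w v
  ... | no _ = 0

record CGraph (n m : ℕ) : Set₁ where
  constructor cgraph
  field
    cends : Ends n m
    present : Fin m → Set

-- contract edge e = (u,v): v is merged into u (every endpoint v is renamed u;
-- v becomes an isolated stray vertex), and e itself is removed.
contractEdge : ∀ {n m} → CGraph n m → Fin m → CGraph n m
contractEdge {n} {m} (cgraph ends pres) e = cgraph ends' pres'
  where
  u = proj₁ (ends e)
  v = proj₂ (ends e)
  σ : Fin n → Fin n
  σ x with x ≟ v
  ... | yes _ = u
  ... | no _ = x
  ends' : Ends n m
  ends' f = σ (proj₁ (ends f)) , σ (proj₂ (ends f))
  pres' : Fin m → Set
  pres' f = pres f × f ≢ e

contractAll : ∀ {n m} → Ends n m → List (Fin m) → CGraph n m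
contractAll ends Fs = foldl contractEdge (cgraph ends (λ _ → Data.Unit.⊤)) Fs
  where import Data.Unit

GraphicIndependent : ∀ {n m} → CGraph n m → (Fin m → Set) → Set
GraphicIndependent (cgraph ends pres) X =
  (∀ e → X e → pres e) × Acyclic ends X

-- An (arbitrary) labelling of the edges incident to each vertex outside R:
-- e1 v, e2 v for nice v; e0 v, e1 v, e2 v for a tent v (values elsewhere irrelevant).
record Labelling {n m} (ends : Ends n m) (R : Subset n) : Set where
  field
    e0 e1 e2 : Fin n → Fin m
    nice-lab : ∀ v → Nice ends R v →
      e1 v ≢ e2 v × Incident ends (e1 v) v × Incident ends (e2 v) v
      × (∀ e → Incident ends e v → e ≡ e1 v ⊎ e ≡ e2 v)
    tent-lab : ∀ v → Tent ends R v →
      e0 v ≢ e1 v × e0 v ≢ e2 v × e1 v ≢ e2 v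
      × Incident ends (e0 v) v × Incident ends (e1 v) v × Incident ends (e2 v) v
      × (∀ e → Incident ends e v → e ≡ e0 v ⊎ e ≡ e1 v ⊎ e ≡ e2 v)

module _ {n m} (ends : Ends n m) (R : Subset n) (L : Labelling ends R) where
  open Labelling L

  InF : Fin m → Set
  InF e = EdgesInside ends R e ⊎ Σ (Fin n) (λ v → Tent ends R v × e ≡ e0 v)

  PairSet : Subset n → Fin m → Set
  PairSet I e = Σ (Fin n) (λ v → v ∈ I × (e ≡ e1 v ⊎ e ≡ e2 v))

  module _ (Fs : List (Fin m)) (w : Fin n → ℕ) where
    H : CGraph n m
    H = contractAll ends Fs

    MaxWeightIndep : Subset n → Set
    MaxWeightIndep I = GraphicIndependent H (PairSet I)
      × (∀ J → J ⊆ ∁ R → GraphicIndependent H (PairSet J) → weight w J ≤ weight w I)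

    MinWeightFVS : Subset n → Set
    MinWeightFVS S = S ⊆ ∁ R × IsFVS ends S
      × (∀ T → T ⊆ ∁ R → IsFVS ends T → weight w S ≤ weight w T)

-- Every edge of G meets R, and a vertex outside R meets F only in the edge e0 of a tent.
-- For J ⊆ V(G) \ R, a cycle of G[R ∪ J] = G \ ((V(G) \ R) \ J) leaves the forest G[R]
-- through some v ∈ J along two distinct edges, at most one of them e0 v; contracting F
-- turns it into a closed walk of H that uses a pair edge of v exactly once, hence into a
-- cycle of pair edges. Conversely a cycle of pair edges in H lifts to G by reconnecting
-- consecutive pair edges through F, and the connecting F-walks can be made to avoid the
-- deleted vertices, since such a walk can only enter a deleted tent along its e0 and
-- must leave the same way. So the pair set of J is independent in M_H exactly when
-- (V(G) \ R) \ J is a feedback vertex set, and complementation inside V(G) \ R, which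
-- reverses weights, exchanges maximum independent pair sets and minimum feedback sets.

module Submission where

open import Defs
open import Data.Nat using (ℕ)
open import Data.Fin using (Fin)
open import Data.Fin.Subset using (Subset; _∉_; _⊆_; ∁; _─_)
open import Data.Sum using (_⊎_)
open import Data.List using (List)
open import Data.List.Membership.Propositional using (_∈_)
open import Function.Bundles using (_⇔_)

open import Data.Nat using (zero; suc; _+_; _*_; _≤_; _<_; z≤n; s≤s)
open import Data.Nat.Properties
  using (module ≤-Reasoning; +-commutativeSemigroup; +-comm; +-identityʳ; +-suc; +-cancelˡ-≡; +-cancelʳ-≤;
         +-monoʳ-≤; <⇒≱)
open import Data.Nat.DivMod
  using (_%_; _/_; m%n<n; n%n≡0; m%n%n≡m%n; [m+n]%n≡m%n; m<n⇒m%n≡m; %-distribˡ-+; m≡m%n+[m/n]*n)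
open import Data.Nat.Divisibility using (divides; ∣⇒≤)
open import Data.Fin using (zero; suc; toℕ; fromℕ; inject₁; _≟_)
open import Data.Fin.Properties
  using (toℕ-injective; toℕ-fromℕ<; toℕ-fromℕ; toℕ-inject₁; toℕ<n; all?; ¬∀⟶∃¬)
open import Data.Fin.Subset using (inside; outside) renaming (_∈_ to _∈ₛ_)
open import Data.Fin.Subset.Properties
  using (_∈?_; x∈p∧x∉q⇒x∈p─q; p─q⊆p; x∈∁p⇒x∉p; x∉p⇒x∈∁p; ⊆-antisym)
import Data.Vec as Vec
open import Data.Product using (Σ; ∃; _×_; _,_; proj₁; proj₂)
open import Data.Sum using (inj₁; inj₂)
open import Data.List using ([]; _∷_; foldl)
open import Data.List.Relation.Unary.Any using (here; there; any?)
open import Data.List.Relation.Unary.All as All using (All)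
open import Data.List.Relation.Unary.All.Properties using (¬Any⇒All¬)
import Data.List.Relation.Unary.AllPairs as AllPairs
open import Data.List.Relation.Unary.Unique.Propositional using (Unique)
open import Data.List.Properties using (tabulate-cong)
open import Data.Nat.ListAction using (sum)
open import Data.Empty using (⊥; ⊥-elim)
open import Data.Unit using (⊤; tt)
open import Relation.Nullary using (¬_; Dec; yes; no)
open import Relation.Binary.PropositionalEquality
open import Function.Bundles using (mk⇔; Equivalence)
open import Algebra.Properties.CommutativeSemigroup +-commutativeSemigroup using (interchange)

-- Weights

-- `weight` sums an anonymous `where`-bound summand; naming it lets `with`
-- case-split on the membership test inside it.
weight-summand : ∀ {n} (w : Fin n → ℕ) (S : Subset n) → Σ (Fin n → ℕ) λ f → weight w S ≡ Σfin f
weight-summand w S = _ , refl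

summand : ∀ {n} → (Fin n → ℕ) → Subset n → Fin n → ℕ
summand w S = proj₁ (weight-summand w S)

summand-∈ : ∀ {n} (w : Fin n → ℕ) {S v} → v ∈ₛ S → summand w S v ≡ w v
summand-∈ w {S} {v} v∈S with v ∈? S
... | yes _ = refl
... | no v∉S = ⊥-elim (v∉S v∈S)

summand-∉ : ∀ {n} (w : Fin n → ℕ) {S v} → v ∉ S → summand w S v ≡ 0
summand-∉ w {S} {v} v∉S with v ∈? S
... | yes v∈S = ⊥-elim (v∉S v∈S)
... | no _ = refl

Σfin-cong : ∀ {k} {f g : Fin k → ℕ} → (∀ v → f v ≡ g v) → Σfin f ≡ Σfin g
Σfin-cong f≗g = cong sum (tabulate-cong f≗g)

Σfin-+ : ∀ {k} (f g : Fin k → ℕ) → Σfin (λ v → f v + g v) ≡ Σfin f + Σfin g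
Σfin-+ {zero} f g = refl
Σfin-+ {suc k} f g = begin
  (f zero + g zero) + Σfin (λ v → f (suc v) + g (suc v))
    ≡⟨ cong ((f zero + g zero) +_) (Σfin-+ (λ v → f (suc v)) (λ v → g (suc v))) ⟩
  (f zero + g zero) + (Σfin (λ v → f (suc v)) + Σfin (λ v → g (suc v)))
    ≡⟨ interchange (f zero) (g zero) _ _ ⟩
  (f zero + Σfin (λ v → f (suc v))) + (g zero + Σfin (λ v → g (suc v))) ∎
  where open ≡-Reasoning

x∈p─q⇒x∉q : ∀ {n} {p q : Subset n} {x} → x ∈ₛ p ─ q → x ∉ q
x∈p─q⇒x∉q {p = inside Vec.∷ _} {outside Vec.∷ _} Vec.here ()
x∈p─q⇒x∉q {p = _ Vec.∷ p} {_ Vec.∷ q} (Vec.there x∈p─q) (Vec.there x∈q) =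
  x∈p─q⇒x∉q {p = p} {q} x∈p─q x∈q

≤-of-complements : ∀ {a b x y c} → a + x ≡ c → b + y ≡ c → y ≤ x → a ≤ b
≤-of-complements {a} {b} {x} {y} a+x≡c b+y≡c y≤x = +-cancelʳ-≤ x a b (begin
  a + x ≡⟨ trans a+x≡c (sym b+y≡c) ⟩
  b + y ≤⟨ +-monoʳ-≤ b y≤x ⟩
  b + x ∎)
  where open ≤-Reasoning

module _ {n} (C : Subset n) where

  ─-involutive : ∀ {T} → T ⊆ C → C ─ (C ─ T) ≡ T
  ─-involutive {T} T⊆C =
    ⊆-antisym into (λ x∈T → x∈p∧x∉q⇒x∈p─q (T⊆C x∈T) (λ x∈C─T → x∈p─q⇒x∉q x∈C─T x∈T))
    where
    into : C ─ (C ─ T) ⊆ T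
    into {x} x∈ with x ∈? T
    ... | yes x∈T = x∈T
    ... | no x∉T = ⊥-elim (x∈p─q⇒x∉q x∈ (x∈p∧x∉q⇒x∈p─q (p─q⊆p C (C ─ T) x∈) x∉T))

  module _ (w : Fin n → ℕ) where

    weight-complement : ∀ {J} → J ⊆ C → weight w (C ─ J) + weight w J ≡ weight w C
    weight-complement {J} J⊆C = begin
      weight w (C ─ J) + weight w J                    ≡⟨ Σfin-+ (summand w (C ─ J)) (summand w J) ⟨
      Σfin (λ v → summand w (C ─ J) v + summand w J v) ≡⟨ Σfin-cong pointwise ⟩
      weight w C                                       ∎
      where
      open ≡-Reasoning
      pointwise : ∀ v → summand w (C ─ J) v + summand w J v ≡ summand w C v
      pointwise v = by-cases (v ∈? J) (v ∈? C)
        where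
        by-cases : Dec (v ∈ₛ J) → Dec (v ∈ₛ C) → summand w (C ─ J) v + summand w J v ≡ summand w C v
        by-cases (yes v∈J) _ = begin
          summand w (C ─ J) v + summand w J v
            ≡⟨ cong₂ _+_ (summand-∉ w (λ v∈C─J → x∈p─q⇒x∉q v∈C─J v∈J)) (summand-∈ w v∈J) ⟩
          w v
            ≡⟨ summand-∈ w (J⊆C v∈J) ⟨
          summand w C v ∎
        by-cases (no v∉J) (yes v∈C) = begin
          summand w (C ─ J) v + summand w J v
            ≡⟨ cong₂ _+_ (summand-∈ w (x∈p∧x∉q⇒x∈p─q v∈C v∉J)) (summand-∉ w v∉J) ⟩
          w v + 0
            ≡⟨ +-identityʳ (w v) ⟩
          w v
            ≡⟨ summand-∈ w v∈C ⟨
          summand w C v ∎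
        by-cases (no v∉J) (no v∉C) = begin
          summand w (C ─ J) v + summand w J v
            ≡⟨ cong₂ _+_ (summand-∉ w (λ v∈C─J → v∉C (p─q⊆p C J v∈C─J))) (summand-∉ w v∉J) ⟩
          0
            ≡⟨ summand-∉ w v∉C ⟨
          summand w C v ∎

    weight-complement′ : ∀ {J} → J ⊆ C → weight w J + weight w (C ─ J) ≡ weight w C
    weight-complement′ {J} J⊆C = trans (+-comm (weight w J) _) (weight-complement J⊆C)

    max-weight⇔min-weight-complement :
      (Ind Cover : Subset n → Set) → (∀ {J} → J ⊆ C → Ind J ⇔ Cover (C ─ J)) →
      ∀ {I} → I ⊆ C →
      (Ind I × (∀ J → J ⊆ C → Ind J → weight w J ≤ weight w I)) ⇔
      (C ─ I ⊆ C × Cover (C ─ I) × (∀ T → T ⊆ C → Cover T → weight w (C ─ I) ≤ weight w T))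
    max-weight⇔min-weight-complement Ind Cover Ind⇔Cover {I} I⊆C = mk⇔ max⇒min min⇒max
      where
      open Equivalence
      IsMax IsMin : Set
      IsMax = Ind I × (∀ J → J ⊆ C → Ind J → weight w J ≤ weight w I)
      IsMin = C ─ I ⊆ C × Cover (C ─ I) × (∀ T → T ⊆ C → Cover T → weight w (C ─ I) ≤ weight w T)
      C─⊆C : ∀ J → C ─ J ⊆ C
      C─⊆C J = p─q⊆p C J
      max⇒min : IsMax → IsMin
      max⇒min (indI , maximal) = C─⊆C I , to (Ind⇔Cover I⊆C) indI , minimal
        where
        minimal : ∀ T → T ⊆ C → Cover T → weight w (C ─ I) ≤ weight w T
        minimal T T⊆C coverT = ≤-of-complements (weight-complement I⊆C) T+C─T
          (maximal (C ─ T) (C─⊆C T) (from (Ind⇔Cover (C─⊆C T)) (subst Cover (sym C─C─T≡T) coverT)))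
          where
          C─C─T≡T : C ─ (C ─ T) ≡ T
          C─C─T≡T = ─-involutive T⊆C
          T+C─T : weight w T + weight w (C ─ T) ≡ weight w C
          T+C─T = subst (λ X → weight w X + weight w (C ─ T) ≡ weight w C) C─C─T≡T (weight-complement (C─⊆C T))
      min⇒max : IsMin → IsMax
      min⇒max (_ , coverC─I , minimal) = from (Ind⇔Cover I⊆C) coverC─I , maximal
        where
        maximal : ∀ J → J ⊆ C → Ind J → weight w J ≤ weight w I
        maximal J J⊆C indJ = ≤-of-complements (weight-complement′ J⊆C) (weight-complement′ I⊆C)
          (minimal (C ─ J) (C─⊆C J) (to (Ind⇔Cover J⊆C) indJ))

-- The cyclic successor on Fin (suc k)

toℕ-next : ∀ {k} (i : Fin (suc k)) → toℕ (next i) ≡ suc (toℕ i) % suc k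
toℕ-next {k} i = toℕ-fromℕ< (m%n<n (suc (toℕ i)) (suc k))

next-inject₁ : ∀ {k} (j : Fin k) → next (inject₁ j) ≡ suc j
next-inject₁ {k} j = toℕ-injective (begin
  toℕ (next (inject₁ j))        ≡⟨ toℕ-next (inject₁ j) ⟩
  suc (toℕ (inject₁ j)) % suc k ≡⟨ cong (λ x → suc x % suc k) (toℕ-inject₁ j) ⟩
  suc (toℕ j) % suc k           ≡⟨ m<n⇒m%n≡m (s≤s (toℕ<n j)) ⟩
  suc (toℕ j)                   ∎)
  where open ≡-Reasoning

next-fromℕ : ∀ k → next (fromℕ k) ≡ zero
next-fromℕ k = toℕ-injective (begin
  toℕ (next (fromℕ k))        ≡⟨ toℕ-next (fromℕ k) ⟩
  suc (toℕ (fromℕ k)) % suc k ≡⟨ cong (λ x → suc x % suc k) (toℕ-fromℕ k) ⟩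
  suc k % suc k               ≡⟨ n%n≡0 (suc k) ⟩
  0                           ∎)
  where open ≡-Reasoning

next^ : ∀ {k} → ℕ → Fin (suc k) → Fin (suc k)
next^ zero i = i
next^ (suc s) i = next^ s (next i)

next-next^ : ∀ {k} s (i : Fin (suc k)) → next (next^ s i) ≡ next^ (suc s) i
next-next^ zero i = refl
next-next^ (suc s) i = next-next^ s (next i)

[m%d+n]%d≡[m+n]%d : ∀ m n d → (m % suc d + n) % suc d ≡ (m + n) % suc d
[m%d+n]%d≡[m+n]%d m n d = begin
  (m % suc d + n) % suc d                 ≡⟨ %-distribˡ-+ (m % suc d) n (suc d) ⟩
  (m % suc d % suc d + n % suc d) % suc d ≡⟨ cong (λ x → (x + n % suc d) % suc d) (m%n%n≡m%n m (suc d)) ⟩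
  (m % suc d + n % suc d) % suc d         ≡⟨ %-distribˡ-+ m n (suc d) ⟨
  (m + n) % suc d                         ∎
  where open ≡-Reasoning

toℕ-next^ : ∀ {k} s (i : Fin (suc k)) → toℕ (next^ s i) ≡ (toℕ i + s) % suc k
toℕ-next^ {k} zero i = begin
  toℕ i                ≡⟨ m<n⇒m%n≡m (toℕ<n i) ⟨
  toℕ i % suc k        ≡⟨ cong (_% suc k) (+-identityʳ (toℕ i)) ⟨
  (toℕ i + 0) % suc k  ∎
  where open ≡-Reasoning
toℕ-next^ {k} (suc s) i = begin
  toℕ (next^ s (next i))            ≡⟨ toℕ-next^ s (next i) ⟩
  (toℕ (next i) + s) % suc k        ≡⟨ cong (λ x → (x + s) % suc k) (toℕ-next i) ⟩
  (suc (toℕ i) % suc k + s) % suc k ≡⟨ [m%d+n]%d≡[m+n]%d (suc (toℕ i)) s k ⟩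
  (suc (toℕ i) + s) % suc k         ≡⟨ cong (_% suc k) (+-suc (toℕ i) s) ⟨
  (toℕ i + suc s) % suc k           ∎
  where open ≡-Reasoning

next^-period : ∀ {k} (i : Fin (suc k)) → next^ (suc k) i ≡ i
next^-period {k} i = toℕ-injective (begin
  toℕ (next^ (suc k) i)     ≡⟨ toℕ-next^ (suc k) i ⟩
  (toℕ i + suc k) % suc k   ≡⟨ [m+n]%n≡m%n (toℕ i) (suc k) ⟩
  toℕ i % suc k             ≡⟨ m<n⇒m%n≡m (toℕ<n i) ⟩
  toℕ i                     ∎)
  where open ≡-Reasoning

-- Returning to i after suc t steps would make suc k divide suc t.
next^-aperiodic : ∀ {k} t → t < k → (i : Fin (suc k)) → next^ (suc t) i ≢ i
next^-aperiodic {k} t t<k i returns = <⇒≱ (s≤s t<k) (∣⇒≤ (divides q s≡q*d))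
  where
  open ≡-Reasoning
  a q : ℕ
  a = toℕ i + suc t
  q = a / suc k
  s≡q*d : suc t ≡ q * suc k
  s≡q*d = +-cancelˡ-≡ (toℕ i) (suc t) (q * suc k) (begin
    a                                 ≡⟨ m≡m%n+[m/n]*n a (suc k) ⟩
    a % suc k + q * suc k             ≡⟨ cong (_+ q * suc k) (toℕ-next^ (suc t) i) ⟨
    toℕ (next^ (suc t) i) + q * suc k ≡⟨ cong (λ x → toℕ x + q * suc k) returns ⟩
    toℕ i + q * suc k                 ∎)

splitAt-last : ∀ {k} (i : Fin (suc k)) → (Σ (Fin k) λ j → i ≡ inject₁ j) ⊎ i ≡ fromℕ k
splitAt-last {zero} zero = inj₂ refl
splitAt-last {suc k} zero = inj₁ (zero , refl)
splitAt-last {suc k} (suc i) with splitAt-last i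
... | inj₁ (j , refl) = inj₁ (suc j , refl)
... | inj₂ refl = inj₂ refl

next-surjective : ∀ {k} (i : Fin (suc k)) → ∃ λ j → next j ≡ i
next-surjective {k} i = next^ k i , trans (next-next^ k i) (next^-period i)

-- Walks, paths and cycles

module Walks {n m} (ends : Ends n m) where

  Joins-endpoint : ∀ {f a b x y} → Joins ends f a b → Joins ends f x y → a ≡ x ⊎ a ≡ y
  Joins-endpoint (inj₁ p) (inj₁ q) = inj₁ (cong proj₁ (trans (sym p) q))
  Joins-endpoint (inj₁ p) (inj₂ q) = inj₂ (cong proj₁ (trans (sym p) q))
  Joins-endpoint (inj₂ p) (inj₁ q) = inj₂ (cong proj₂ (trans (sym p) q))
  Joins-endpoint (inj₂ p) (inj₂ q) = inj₁ (cong proj₂ (trans (sym p) q))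

  Joins-backtrack : ∀ {f x z t} → Joins ends f x z → Joins ends f z t → x ≢ z → t ≡ x
  Joins-backtrack (inj₁ p) (inj₁ q) x≢z = ⊥-elim (x≢z (cong proj₁ (trans (sym p) q)))
  Joins-backtrack (inj₁ p) (inj₂ q) _ = cong proj₁ (trans (sym q) p)
  Joins-backtrack (inj₂ p) (inj₁ q) _ = cong proj₂ (trans (sym q) p)
  Joins-backtrack (inj₂ p) (inj₂ q) x≢z = ⊥-elim (x≢z (cong proj₂ (trans (sym p) q)))

  Joins-incident : ∀ {f x y} → Joins ends f x y → Incident ends f x × Incident ends f y
  Joins-incident (inj₁ eq) = inj₁ (cong proj₁ eq) , inj₂ (cong proj₂ eq)
  Joins-incident (inj₂ eq) = inj₂ (cong proj₂ eq) , inj₁ (cong proj₁ eq)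

  joined⇒endpoints : ∀ {P : Fin n → Set} {f x y} → Joins ends f x y → P x × P y →
    P (proj₁ (ends f)) × P (proj₂ (ends f))
  joined⇒endpoints (inj₁ refl) (Px , Py) = Px , Py
  joined⇒endpoints (inj₂ refl) (Px , Py) = Py , Px

  endpoints⇒joined : ∀ {P : Fin n → Set} {f x y} → Joins ends f x y →
    P (proj₁ (ends f)) × P (proj₂ (ends f)) → P x × P y
  endpoints⇒joined (inj₁ refl) (P₁ , P₂) = P₁ , P₂
  endpoints⇒joined (inj₂ refl) (P₁ , P₂) = P₂ , P₁

  data Walk (P : Fin m → Set) : Fin n → Fin n → Set where
    nil  : ∀ {a} → Walk P a a
    cons : ∀ {a b c} (e : Fin m) → P e → Joins ends e a b → Walk P b c → Walk P a c

  _++ʷ_ : ∀ {P a b c} → Walk P a b → Walk P b c → Walk P a c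
  nil ++ʷ v = v
  cons e p j u ++ʷ v = cons e p j (u ++ʷ v)

  mapʷ : ∀ {P Q : Fin m → Set} {a b} → (∀ {f} → P f → Q f) → Walk P a b → Walk Q a b
  mapʷ P⇒Q nil = nil
  mapʷ P⇒Q (cons e p j w) = cons e (P⇒Q p) j (mapʷ P⇒Q w)

  vertices : ∀ {P a b} → Walk P a b → List (Fin n)
  vertices {a = a} nil = a ∷ []
  vertices {a = a} (cons _ _ _ w) = a ∷ vertices w

  IsPath : ∀ {P a b} → Walk P a b → Set
  IsPath w = Unique (vertices w)

  start-∈ : ∀ {P a b} (w : Walk P a b) → a ∈ vertices w
  start-∈ nil = here refl
  start-∈ (cons _ _ _ _) = here refl

  suffix-path : ∀ {P a b c} (w : Walk P b c) → a ∈ vertices w → IsPath w → Σ (Walk P a c) IsPath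
  suffix-path nil (here refl) w-path = nil , w-path
  suffix-path w@(cons _ _ _ _) (here refl) w-path = w , w-path
  suffix-path (cons _ _ _ w) (there a∈w) (_ AllPairs.∷ w-path) = suffix-path w a∈w w-path

  walk⇒path : ∀ {P a b} → Walk P a b → Σ (Walk P a b) IsPath
  walk⇒path nil = nil , (All.[] AllPairs.∷ AllPairs.[])
  walk⇒path {a = a} (cons e p j w) with walk⇒path w
  ... | w′ , w′-path with any? (a ≟_) (vertices w′)
  ...   | yes a∈w′ = suffix-path w′ a∈w′ w′-path
  ...   | no a∉w′ = cons e p j w′ , (¬Any⇒All¬ (vertices w′) a∉w′ AllPairs.∷ w′-path)

  length : ∀ {P a b} → Walk P a b → ℕ
  length nil = zero
  length (cons _ _ _ w) = suc (length w)

  vertexAt : ∀ {P a b} (w : Walk P a b) → Fin (suc (length w)) → Fin n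
  vertexAt {a = a} nil zero = a
  vertexAt {a = a} (cons _ _ _ _) zero = a
  vertexAt (cons _ _ _ w) (suc i) = vertexAt w i

  -- The edges of w, followed by a closing edge e from its end back to its start.
  closedEdgeAt : ∀ {P a b} (w : Walk P a b) → Fin m → Fin (suc (length w)) → Fin m
  closedEdgeAt nil e zero = e
  closedEdgeAt (cons f _ _ _) e zero = f
  closedEdgeAt (cons _ _ _ w) e (suc i) = closedEdgeAt w e i

  vertexAt-zero : ∀ {P a b} (w : Walk P a b) → vertexAt w zero ≡ a
  vertexAt-zero nil = refl
  vertexAt-zero (cons _ _ _ _) = refl

  vertexAt-last : ∀ {P a b} (w : Walk P a b) → vertexAt w (fromℕ (length w)) ≡ b
  vertexAt-last nil = refl
  vertexAt-last (cons _ _ _ w) = vertexAt-last w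

  closedEdgeAt-last : ∀ {P a b} (w : Walk P a b) e → closedEdgeAt w e (fromℕ (length w)) ≡ e
  closedEdgeAt-last nil e = refl
  closedEdgeAt-last (cons _ _ _ w) e = closedEdgeAt-last w e

  vertexAt-∈ : ∀ {P a b} (w : Walk P a b) i → vertexAt w i ∈ vertices w
  vertexAt-∈ nil zero = here refl
  vertexAt-∈ (cons _ _ _ _) zero = here refl
  vertexAt-∈ (cons _ _ _ w) (suc i) = there (vertexAt-∈ w i)

  vertexAt-injective : ∀ {P a b} (w : Walk P a b) → IsPath w →
    ∀ i j → vertexAt w i ≡ vertexAt w j → i ≡ j
  vertexAt-injective nil _ zero zero _ = refl
  vertexAt-injective (cons _ _ _ _) _ zero zero _ = refl
  vertexAt-injective (cons _ _ _ w) (a∉w AllPairs.∷ _) zero (suc j) eq =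
    ⊥-elim (All.lookup a∉w (vertexAt-∈ w j) eq)
  vertexAt-injective (cons _ _ _ w) (a∉w AllPairs.∷ _) (suc i) zero eq =
    ⊥-elim (All.lookup a∉w (vertexAt-∈ w i) (sym eq))
  vertexAt-injective (cons _ _ _ w) (_ AllPairs.∷ w-path) (suc i) (suc j) eq =
    cong suc (vertexAt-injective w w-path i j eq)

  closedEdgeAt-joins : ∀ {P a b} (w : Walk P a b) e (j : Fin (length w)) →
    Joins ends (closedEdgeAt w e (inject₁ j)) (vertexAt w (inject₁ j)) (vertexAt w (suc j))
  closedEdgeAt-joins (cons f _ f-joins w) e zero = subst (Joins ends f _) (sym (vertexAt-zero w)) f-joins
  closedEdgeAt-joins (cons _ _ _ w) e (suc j) = closedEdgeAt-joins w e j

  closedEdgeAt-cases : ∀ {Q a b} (w : Walk Q a b) e i → closedEdgeAt w e i ≡ e ⊎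
    (Q (closedEdgeAt w e i) ×
     Σ (Fin n) λ x → Σ (Fin n) λ y → x ∈ vertices w × y ∈ vertices w × Joins ends (closedEdgeAt w e i) x y)
  closedEdgeAt-cases nil e zero = inj₁ refl
  closedEdgeAt-cases (cons f q f-joins w) e zero = inj₂ (q , _ , _ , here refl , there (start-∈ w) , f-joins)
  closedEdgeAt-cases (cons _ _ _ w) e (suc i) with closedEdgeAt-cases w e i
  ... | inj₁ closing = inj₁ closing
  ... | inj₂ (q , x , y , x∈w , y∈w , joins) = inj₂ (q , x , y , there x∈w , there y∈w , joins)

  -- On a path, an edge leaving the start vertex cannot recur: it would touch the start again.
  first-edge-fresh : ∀ {Q a b c} f → Q f → Joins ends f a b → (w : Walk Q b c) → ∀ e →
    (∀ {g} → Q g → g ≢ e) → All (a ≢_) (vertices w) → ∀ j → f ≢ closedEdgeAt w e j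
  first-edge-fresh f q f-joins w e Q⇒≢e a∉w j f≡ with closedEdgeAt-cases w e j
  ... | inj₁ closing = Q⇒≢e q (trans f≡ closing)
  ... | inj₂ (_ , x , y , x∈w , y∈w , joins)
    with Joins-endpoint f-joins (subst (λ g → Joins ends g x y) (sym f≡) joins)
  ...   | inj₁ refl = All.lookup a∉w x∈w refl
  ...   | inj₂ refl = All.lookup a∉w y∈w refl

  closedEdgeAt-injective : ∀ {Q a b} (w : Walk Q a b) e → (∀ {g} → Q g → g ≢ e) → IsPath w →
    ∀ i j → closedEdgeAt w e i ≡ closedEdgeAt w e j → i ≡ j
  closedEdgeAt-injective nil e _ _ zero zero _ = refl
  closedEdgeAt-injective (cons _ _ _ _) e _ _ zero zero _ = refl
  closedEdgeAt-injective (cons f q f-joins w) e Q⇒≢e (a∉w AllPairs.∷ _) zero (suc j) eq =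
    ⊥-elim (first-edge-fresh f q f-joins w e Q⇒≢e a∉w j eq)
  closedEdgeAt-injective (cons f q f-joins w) e Q⇒≢e (a∉w AllPairs.∷ _) (suc i) zero eq =
    ⊥-elim (first-edge-fresh f q f-joins w e Q⇒≢e a∉w i (sym eq))
  closedEdgeAt-injective (cons _ _ _ w) e Q⇒≢e (_ AllPairs.∷ w-path) (suc i) (suc j) eq =
    cong suc (closedEdgeAt-injective w e Q⇒≢e w-path i j eq)

  path⇒cycle : ∀ {P a b} e → P e → Joins ends e a b →
    (w : Walk (λ f → P f × f ≢ e) b a) → IsPath w → Cycle ends P
  path⇒cycle {P} e pe e-joins w w-path = record
    { len = length w
    ; vs = vertexAt w
    ; es = closedEdgeAt w e
    ; vs-inj = λ {i} {j} → vertexAt-injective w w-path i j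
    ; es-inj = λ {i} {j} → closedEdgeAt-injective w e proj₂ w-path i j
    ; es-in = es-in
    ; joins = joins
    }
    where
    es-in : ∀ i → P (closedEdgeAt w e i)
    es-in i with closedEdgeAt-cases w e i
    ... | inj₁ closing = subst P (sym closing) pe
    ... | inj₂ ((p , _) , _) = p
    joins : ∀ i → Joins ends (closedEdgeAt w e i) (vertexAt w i) (vertexAt w (next i))
    joins i with splitAt-last i
    ... | inj₁ (j , refl) =
      subst (λ x → Joins ends (closedEdgeAt w e (inject₁ j)) (vertexAt w (inject₁ j)) (vertexAt w x))
            (sym (next-inject₁ j)) (closedEdgeAt-joins w e j)
    ... | inj₂ refl
      rewrite next-fromℕ (length w) | closedEdgeAt-last w e | vertexAt-last w | vertexAt-zero w = e-joins

  walk⇒cycle : ∀ {P a b} e → P e → Joins ends e a b → Walk (λ f → P f × f ≢ e) b a → Cycle ends P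
  walk⇒cycle e pe e-joins w = path⇒cycle e pe e-joins (proj₁ (walk⇒path w)) (proj₂ (walk⇒path w))

  module _ {P : Fin m → Set} (C : Cycle ends P) where
    open Cycle C

    walk-along : ∀ i s j → (∀ t → t < s → es (next^ t j) ≢ es i) →
      Walk (λ f → P f × f ≢ es i) (vs j) (vs (next^ s j))
    walk-along i zero j _ = nil
    walk-along i (suc s) j avoids = cons (es j) (es-in j , avoids 0 (s≤s z≤n)) (joins j)
      (walk-along i s (next j) (λ t t<s → avoids (suc t) (s≤s t<s)))

    around : ∀ i → Walk (λ f → P f × f ≢ es i) (vs (next i)) (vs i)
    around i = subst (Walk _ (vs (next i))) (cong vs (next^-period i))
      (walk-along i len (next i) (λ t t<len eq → next^-aperiodic t t<len i (es-inj eq)))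

-- Contraction

-- The vertex renaming σ of `contractEdge`: the second endpoint becomes the first.
merge : ∀ {n} → Fin n × Fin n → Fin n → Fin n
merge (u , v) x with x ≟ v
... | yes _ = u
... | no _ = x

merge-glues : ∀ {n} (c : Fin n × Fin n) → merge c (proj₁ c) ≡ merge c (proj₂ c)
merge-glues (u , v) with u ≟ v | v ≟ v
... | _ | no v≢v = ⊥-elim (v≢v refl)
... | yes _ | yes _ = refl
... | no _ | yes _ = refl

merge-identifies : ∀ {n} (c : Fin n × Fin n) x y → merge c x ≡ merge c y →
  x ≡ y ⊎ (x ≡ proj₂ c × y ≡ proj₁ c) ⊎ (x ≡ proj₁ c × y ≡ proj₂ c)
merge-identifies (u , v) x y eq with x ≟ v | y ≟ v
... | yes x≡v | yes y≡v = inj₁ (trans x≡v (sym y≡v))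
... | yes x≡v | no _ = inj₂ (inj₁ (x≡v , sym eq))
... | no _ | yes y≡v = inj₂ (inj₂ (eq , y≡v))
... | no _ | no _ = inj₁ eq

contractEdge-ends : ∀ {n m} (C : CGraph n m) e f → CGraph.cends (contractEdge C e) f ≡
  (merge (CGraph.cends C e) (proj₁ (CGraph.cends C f)) , merge (CGraph.cends C e) (proj₂ (CGraph.cends C f)))
contractEdge-ends (cgraph ends _) e f with proj₁ (ends f) ≟ proj₂ (ends e) | proj₂ (ends f) ≟ proj₂ (ends e)
... | yes _ | yes _ = refl
... | yes _ | no _ = refl
... | no _ | yes _ = refl
... | no _ | no _ = refl

-- H arises from G by contracting exactly the edges D, identifying vertices along ρ.
record Contraction {n m} (ends : Ends n m) (D : Fin m → Set) (H : CGraph n m) : Set where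
  field
    ρ        : Fin n → Fin n
    ends-ρ   : ∀ f → CGraph.cends H f ≡ (ρ (proj₁ (ends f)) , ρ (proj₂ (ends f)))
    present  : ∀ f → ¬ D f → CGraph.present H f
    glues    : ∀ f → D f → ρ (proj₁ (ends f)) ≡ ρ (proj₂ (ends f))
    connects : ∀ x y → ρ x ≡ ρ y → Walks.Walk ends D x y

module _ {n m} (ends : Ends n m) where
  open Walks ends

  Contraction-resp : ∀ {D D′ H} → (∀ {f} → D f → D′ f) → (∀ {f} → D′ f → D f) →
    Contraction ends D H → Contraction ends D′ H
  Contraction-resp D⇒D′ D′⇒D K = record
    { ρ = ρ ; ends-ρ = ends-ρ
    ; present = λ f ¬D′f → present f (λ Df → ¬D′f (D⇒D′ Df))
    ; glues = λ f D′f → glues f (D′⇒D D′f)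
    ; connects = λ x y ρx≡ρy → mapʷ D⇒D′ (connects x y ρx≡ρy)
    }
    where open Contraction K

  contractEdge-contraction : ∀ {D H} → Contraction ends D H → ∀ e →
    Contraction ends (λ f → D f ⊎ f ≡ e) (contractEdge H e)
  contractEdge-contraction {D} {H} K e = record
    { ρ = ρ′
    ; ends-ρ = ends-ρ′
    ; present = λ f ¬D′f → present f (λ Df → ¬D′f (inj₁ Df)) , λ f≡e → ¬D′f (inj₂ f≡e)
    ; glues = glues′
    ; connects = connects′
    }
    where
    open Contraction K
    c : Fin n × Fin n
    c = CGraph.cends H e
    u v : Fin n
    u = proj₁ (ends e)
    v = proj₂ (ends e)
    c≡ : c ≡ (ρ u , ρ v)
    c≡ = ends-ρ e
    ρ′ : Fin n → Fin n
    ρ′ x = merge c (ρ x)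
    ends-ρ′ : ∀ f → CGraph.cends (contractEdge H e) f ≡ (ρ′ (proj₁ (ends f)) , ρ′ (proj₂ (ends f)))
    ends-ρ′ f = trans (contractEdge-ends H e f) (cong (λ p → merge c (proj₁ p) , merge c (proj₂ p)) (ends-ρ f))
    glues′ : ∀ f → D f ⊎ f ≡ e → ρ′ (proj₁ (ends f)) ≡ ρ′ (proj₂ (ends f))
    glues′ f (inj₁ Df) = cong (merge c) (glues f Df)
    glues′ f (inj₂ refl) = begin
      merge c (ρ u)         ≡⟨ cong (merge c) (cong proj₁ c≡) ⟨
      merge c (proj₁ c)     ≡⟨ merge-glues c ⟩
      merge c (proj₂ c)     ≡⟨ cong (merge c) (cong proj₂ c≡) ⟩
      merge c (ρ v)         ∎
      where open ≡-Reasoning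
    old : ∀ {x y} → ρ x ≡ ρ y → Walk (λ f → D f ⊎ f ≡ e) x y
    old {x} {y} ρx≡ρy = mapʷ inj₁ (connects x y ρx≡ρy)
    connects′ : ∀ x y → ρ′ x ≡ ρ′ y → Walk (λ f → D f ⊎ f ≡ e) x y
    connects′ x y eq with merge-identifies c (ρ x) (ρ y) eq
    ... | inj₁ ρx≡ρy = old ρx≡ρy
    ... | inj₂ (inj₁ (x↦v , y↦u)) =
      old (trans x↦v (cong proj₂ c≡)) ++ʷ
      cons e (inj₂ refl) (inj₂ refl) (old (trans (sym (cong proj₁ c≡)) (sym y↦u)))
    ... | inj₂ (inj₂ (x↦u , y↦v)) =
      old (trans x↦u (cong proj₁ c≡)) ++ʷ
      cons e (inj₂ refl) (inj₁ refl) (old (trans (sym (cong proj₂ c≡)) (sym y↦v)))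

  foldl-contractEdge-contraction : ∀ {D H} → Contraction ends D H → ∀ Fs →
    Contraction ends (λ f → D f ⊎ f ∈ Fs) (foldl contractEdge H Fs)
  foldl-contractEdge-contraction K [] = Contraction-resp inj₁ (λ { (inj₁ Df) → Df ; (inj₂ ()) }) K
  foldl-contractEdge-contraction {D} K (e ∷ Fs) =
    Contraction-resp regroup ungroup (foldl-contractEdge-contraction (contractEdge-contraction K e) Fs)
    where
    regroup : ∀ {f} → (D f ⊎ f ≡ e) ⊎ f ∈ Fs → D f ⊎ f ∈ e ∷ Fs
    regroup (inj₁ (inj₁ Df)) = inj₁ Df
    regroup (inj₁ (inj₂ f≡e)) = inj₂ (here f≡e)
    regroup (inj₂ f∈Fs) = inj₂ (there f∈Fs)
    ungroup : ∀ {f} → D f ⊎ f ∈ e ∷ Fs → (D f ⊎ f ≡ e) ⊎ f ∈ Fs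
    ungroup (inj₁ Df) = inj₁ (inj₁ Df)
    ungroup (inj₂ (here f≡e)) = inj₁ (inj₂ f≡e)
    ungroup (inj₂ (there f∈Fs)) = inj₂ f∈Fs

  contractAll-contraction : ∀ Fs → Contraction ends (_∈ Fs) (contractAll ends Fs)
  contractAll-contraction Fs =
    Contraction-resp (λ { (inj₁ ()) ; (inj₂ f∈Fs) → f∈Fs }) inj₂ (foldl-contractEdge-contraction identity Fs)
    where
    identity : Contraction ends (λ _ → ⊥) (cgraph ends (λ _ → ⊤))
    identity = record
      { ρ = λ x → x ; ends-ρ = λ _ → refl ; present = λ _ _ → tt
      ; glues = λ _ () ; connects = λ { x .x refl → nil } }

module _ {n m} {ends : Ends n m} {D : Fin m → Set} {H : CGraph n m} (K : Contraction ends D H) where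
  open Contraction K
  private
    module G = Walks ends
    module H = Walks (CGraph.cends H)

  Joins-ρ : ∀ {f x y} → Joins ends f x y → Joins (CGraph.cends H) f (ρ x) (ρ y)
  Joins-ρ {f} (inj₁ eq) = inj₁ (trans (ends-ρ f) (cong (λ p → ρ (proj₁ p) , ρ (proj₂ p)) eq))
  Joins-ρ {f} (inj₂ eq) = inj₂ (trans (ends-ρ f) (cong (λ p → ρ (proj₁ p) , ρ (proj₂ p)) eq))

  Joins-ρ⁻¹ : ∀ {f x′ y′} → Joins (CGraph.cends H) f x′ y′ →
    Σ (Fin n) λ x → Σ (Fin n) λ y → Joins ends f x y × ρ x ≡ x′ × ρ y ≡ y′
  Joins-ρ⁻¹ {f} {x′} {y′} (inj₁ eq) = _ , _ , inj₁ refl , cong proj₁ ρ-ends≡ , cong proj₂ ρ-ends≡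
    where
    ρ-ends≡ : (ρ (proj₁ (ends f)) , ρ (proj₂ (ends f))) ≡ (x′ , y′)
    ρ-ends≡ = trans (sym (ends-ρ f)) eq
  Joins-ρ⁻¹ {f} {x′} {y′} (inj₂ eq) = _ , _ , inj₂ refl , cong proj₂ ρ-ends≡ , cong proj₁ ρ-ends≡
    where
    ρ-ends≡ : (ρ (proj₁ (ends f)) , ρ (proj₂ (ends f))) ≡ (y′ , x′)
    ρ-ends≡ = trans (sym (ends-ρ f)) eq

  glues-Joins : ∀ {f x y} → D f → Joins ends f x y → ρ x ≡ ρ y
  glues-Joins {f} Df (inj₁ refl) = glues f Df
  glues-Joins {f} Df (inj₂ refl) = sym (glues f Df)

  project : ∀ {Q X : Fin m → Set} → (∀ {f} → Q f → D f ⊎ X f) →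
    ∀ {x y} → G.Walk Q x y → H.Walk X (ρ x) (ρ y)
  project classify G.nil = H.nil
  project {X = X} classify {y = y} (G.cons f Qf f-joins w) with classify Qf
  ... | inj₁ Df = subst (λ z → H.Walk X z (ρ y)) (sym (glues-Joins Df f-joins)) (project classify w)
  ... | inj₂ Xf = H.cons f Xf (Joins-ρ f-joins) (project classify w)

  -- Between consecutive edges of an H-walk, `bridge` reconnects the endpoints that ρ identifies.
  lift : ∀ {Q X : Fin m → Set} (Good : Fin n → Set) →
    (∀ {f x y} → X f → Joins ends f x y → Q f × Good x × Good y) →
    (∀ {x y} → ρ x ≡ ρ y → Good x → Good y → G.Walk Q x y) →
    ∀ {x′ y′} → H.Walk X x′ y′ → ∀ {x y} → ρ x ≡ x′ → Good x → ρ y ≡ y′ → Good y → G.Walk Q x y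
  lift Good X⇒Q bridge H.nil ρx≡ good-x ρy≡ good-y = bridge (trans ρx≡ (sym ρy≡)) good-x good-y
  lift Good X⇒Q bridge (H.cons f Xf f-joins w) ρx≡ good-x ρy≡ good-y with Joins-ρ⁻¹ f-joins
  ... | a , b , f-joins′ , ρa≡ , ρb≡ with X⇒Q Xf f-joins′
  ...   | Qf , good-a , good-b =
    bridge (trans ρx≡ (sym ρa≡)) good-x good-a G.++ʷ
    G.cons f Qf f-joins′ (lift Good X⇒Q bridge w ρb≡ good-b ρy≡ good-y)

  project-cycle : ∀ {Q X : Fin m → Set} → (∀ {f} → Q f → D f ⊎ X f) →
    (C : Cycle ends Q) → (Σ (Fin (suc (Cycle.len C))) λ i → X (Cycle.es C i)) → Cycle (CGraph.cends H) X
  project-cycle {Q} {X} classify C (i , X-esi) =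
    H.walk⇒cycle (es i) X-esi (Joins-ρ (joins i)) (project classify′ (G.around C i))
    where
    open Cycle C
    classify′ : ∀ {f} → Q f × f ≢ es i → D f ⊎ (X f × f ≢ es i)
    classify′ (Qf , f≢esi) with classify Qf
    ... | inj₁ Df = inj₁ Df
    ... | inj₂ Xf = inj₂ (Xf , f≢esi)

  lift-cycle : ∀ {Q X : Fin m → Set} (Good : Fin n → Set) →
    (∀ {f x y} → X f → Joins ends f x y → Q f × Good x × Good y) →
    (∀ {f} → X f → ¬ D f) →
    (∀ {x y} → ρ x ≡ ρ y → Good x → Good y → G.Walk (λ f → D f × Q f) x y) →
    Cycle (CGraph.cends H) X → Cycle ends Q
  lift-cycle {Q} {X} Good X⇒Q X⇒¬D bridge C = close (Joins-ρ⁻¹ (joins zero))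
    where
    open Cycle C
    e : Fin m
    e = es zero
    X′⇒Q′ : ∀ {f x y} → X f × f ≢ e → Joins ends f x y → (Q f × f ≢ e) × Good x × Good y
    X′⇒Q′ (Xf , f≢e) f-joins with X⇒Q Xf f-joins
    ... | Qf , good-x , good-y = (Qf , f≢e) , good-x , good-y
    bridge′ : ∀ {x y} → ρ x ≡ ρ y → Good x → Good y → G.Walk (λ f → Q f × f ≢ e) x y
    bridge′ ρx≡ρy good-x good-y =
      G.mapʷ (λ { (Df , Qf) → Qf , λ { refl → X⇒¬D (es-in zero) Df } }) (bridge ρx≡ρy good-x good-y)
    close : (Σ (Fin n) λ x → Σ (Fin n) λ y → Joins ends e x y × ρ x ≡ vs zero × ρ y ≡ vs (next zero)) → Cycle ends Q
    close (a , b , e-joins , ρa≡ , ρb≡) with X⇒Q (es-in zero) e-joins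
    ... | Qe , good-a , good-b =
      G.walk⇒cycle e Qe e-joins (lift Good X′⇒Q′ bridge′ (H.around C zero) ρb≡ good-b ρa≡ good-a)

-- Nice vertices and tents

module NiceTent {n m} (ends : Ends n m) (R : Subset n)
  (nice-or-tent : ∀ v → v ∉ R → Nice ends R v ⊎ Tent ends R v)
  (L : Labelling ends R) where

  open Labelling L
  open Walks ends

  neighbours-in-R : ∀ {v} → v ∉ R → NeighboursIn ends R v
  neighbours-in-R {v} v∉R with nice-or-tent v v∉R
  ... | inj₁ (_ , _ , in-R) = in-R
  ... | inj₂ (_ , _ , in-R) = in-R

  edge-meets-R : ∀ f → proj₁ (ends f) ∉ R → proj₂ (ends f) ∉ R → ⊥
  edge-meets-R f ∉R₁ ∉R₂ = ∉R₂ (proj₁ (neighbours-in-R ∉R₁ f) refl)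

  no-loop-outside-R : ∀ {f v} → Joins ends f v v → v ∉ R → ⊥
  no-loop-outside-R {f} loop v∉R with joined⇒endpoints {P = _∉ R} loop (v∉R , v∉R)
  ... | ∉R₁ , ∉R₂ = edge-meets-R f ∉R₁ ∉R₂

  pair-incident : ∀ {v f} → v ∉ R → f ≡ e1 v ⊎ f ≡ e2 v → Incident ends f v
  pair-incident {v} v∉R f∈pair with nice-or-tent v v∉R
  ... | inj₁ nice with nice-lab v nice | f∈pair
  ...   | _ , inc₁ , _ , _ | inj₁ refl = inc₁
  ...   | _ , _ , inc₂ , _ | inj₂ refl = inc₂
  pair-incident {v} v∉R f∈pair | inj₂ tent with tent-lab v tent | f∈pair
  ...   | _ , _ , _ , _ , inc₁ , _ | inj₁ refl = inc₁
  ...   | _ , _ , _ , _ , _ , inc₂ , _ | inj₂ refl = inc₂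

  incident-label : ∀ {v f} → v ∉ R → Incident ends f v → (Tent ends R v × f ≡ e0 v) ⊎ (f ≡ e1 v ⊎ f ≡ e2 v)
  incident-label {v} {f} v∉R f∋v with nice-or-tent v v∉R
  ... | inj₁ nice with nice-lab v nice
  ...   | _ , _ , _ , only-pair = inj₂ (only-pair f f∋v)
  incident-label {v} {f} v∉R f∋v | inj₂ tent with tent-lab v tent
  ...   | _ , _ , _ , _ , _ , _ , only-three with only-three f f∋v
  ...     | inj₁ f≡e0 = inj₁ (tent , f≡e0)
  ...     | inj₂ f∈pair = inj₂ f∈pair

  one-endpoint-outside-R : ∀ {f u v} → Incident ends f u → Incident ends f v → u ∉ R → v ∉ R → u ≡ v
  one-endpoint-outside-R (inj₁ p) (inj₁ q) _ _ = trans (sym p) q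
  one-endpoint-outside-R (inj₂ p) (inj₂ q) _ _ = trans (sym p) q
  one-endpoint-outside-R {f} (inj₁ p) (inj₂ q) u∉R v∉R =
    ⊥-elim (edge-meets-R f (subst (_∉ R) (sym p) u∉R) (subst (_∉ R) (sym q) v∉R))
  one-endpoint-outside-R {f} (inj₂ p) (inj₁ q) u∉R v∉R =
    ⊥-elim (edge-meets-R f (subst (_∉ R) (sym q) v∉R) (subst (_∉ R) (sym p) u∉R))

  F-edge-outside-R : ∀ {v f} → v ∉ R → Incident ends f v → InF ends R L f → Tent ends R v × f ≡ e0 v
  F-edge-outside-R v∉R (inj₁ refl) (inj₁ (∈R , _)) = ⊥-elim (v∉R ∈R)
  F-edge-outside-R v∉R (inj₂ refl) (inj₁ (_ , ∈R)) = ⊥-elim (v∉R ∈R)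
  F-edge-outside-R v∉R f∋v (inj₂ (u , tent-u , refl)) with tent-lab u tent-u
  ... | _ , _ , _ , e0∋u , _ with one-endpoint-outside-R e0∋u f∋v (proj₁ tent-u) v∉R
  ...   | refl = tent-u , refl

  pair-∉F : ∀ {v f} → v ∉ R → f ≡ e1 v ⊎ f ≡ e2 v → ¬ InF ends R L f
  pair-∉F {v} v∉R f∈pair f∈F with F-edge-outside-R v∉R (pair-incident v∉R f∈pair) f∈F
  ... | tent , f≡e0 with tent-lab v tent | f∈pair
  ...   | e0≢e1 , _ | inj₁ f≡e1 = e0≢e1 (trans (sym f≡e0) f≡e1)
  ...   | _ , e0≢e2 , _ | inj₂ f≡e2 = e0≢e2 (trans (sym f≡e0) f≡e2)

  module _ (J : Subset n) where

    S : Subset n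
    S = ∁ R ─ J

    ∈S⇒∉R : ∀ {x} → x ∈ₛ S → x ∉ R
    ∈S⇒∉R x∈S = x∈∁p⇒x∉p (p─q⊆p (∁ R) J x∈S)

    ∈R⇒∉S : ∀ {x} → x ∈ₛ R → x ∉ S
    ∈R⇒∉S x∈R x∈S = ∈S⇒∉R x∈S x∈R

    ∉S⇒∈J : ∀ {x} → x ∉ S → x ∉ R → x ∈ₛ J
    ∉S⇒∈J {x} x∉S x∉R with x ∈? J
    ... | yes x∈J = x∈J
    ... | no x∉J = ⊥-elim (x∉S (x∈p∧x∉q⇒x∈p─q (x∉p⇒x∈∁p x∉R) x∉J))

    edge-at-kept-vertex : ∀ {v f} → v ∉ R → v ∉ S → Incident ends f v → InF ends R L f ⊎ PairSet ends R L J f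
    edge-at-kept-vertex {v} v∉R v∉S f∋v with incident-label v∉R f∋v
    ... | inj₁ (tent , f≡e0) = inj₁ (inj₂ (v , tent , f≡e0))
    ... | inj₂ f∈pair = inj₂ (v , ∉S⇒∈J v∉S v∉R , f∈pair)

    -- An edge of G \ S lying outside G[R] has an endpoint outside R, which must be in J.
    classify : ∀ {f} → EdgesAvoiding ends S f → InF ends R L f ⊎ PairSet ends R L J f
    classify {f} (∉S₁ , ∉S₂) with proj₁ (ends f) ∈? R | proj₂ (ends f) ∈? R
    ... | yes ∈R₁ | yes ∈R₂ = inj₁ (inj₁ (∈R₁ , ∈R₂))
    ... | no ∉R₁ | _ = edge-at-kept-vertex ∉R₁ ∉S₁ (inj₁ refl)
    ... | yes _ | no ∉R₂ = edge-at-kept-vertex ∉R₂ ∉S₂ (inj₂ refl)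

    pair-edge-kept : J ⊆ ∁ R → ∀ {f x y} → PairSet ends R L J f → Joins ends f x y →
      EdgesAvoiding ends S f × x ∉ S × y ∉ S
    pair-edge-kept J⊆∁R {f} (v , v∈J , f∈pair) f-joins = kept , endpoints⇒joined f-joins kept
      where
      v∉R : v ∉ R
      v∉R = x∈∁p⇒x∉p (J⊆∁R v∈J)
      v∉S : v ∉ S
      v∉S v∈S = x∈p─q⇒x∉q v∈S v∈J
      endpoints : ∀ {f} → Incident ends f v → EdgesAvoiding ends S f
      endpoints {f} (inj₁ refl) = v∉S , ∈R⇒∉S (proj₁ (neighbours-in-R v∉R f) refl)
      endpoints {f} (inj₂ refl) = ∈R⇒∉S (proj₂ (neighbours-in-R v∉R f) refl) , v∉S
      kept : EdgesAvoiding ends S f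
      kept = endpoints (pair-incident v∉R f∈pair)

    FS-Walk : Fin n → Fin n → Set
    FS-Walk = Walk (λ f → InF ends R L f × EdgesAvoiding ends S f)

    -- The only F-edge at a vertex z ∈ S is e0 z, so an F-walk entering z leaves along the same edge.
    F-walk-avoiding-S : ∀ {x y} → Walk (InF ends R L) x y → x ∉ S → y ∉ S → FS-Walk x y
    F-walk-avoiding-S-via : ∀ {x z y} f → InF ends R L f → Joins ends f x z → Walk (InF ends R L) z y →
      x ∉ S → y ∉ S → Dec (z ∈ₛ S) → FS-Walk x y

    F-walk-avoiding-S nil _ _ = nil
    F-walk-avoiding-S (cons {b = z} f f∈F f-joins w) x∉S y∉S =
      F-walk-avoiding-S-via f f∈F f-joins w x∉S y∉S (z ∈? S)

    F-walk-avoiding-S-via f f∈F f-joins w x∉S y∉S (no z∉S) =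
      cons f (f∈F , joined⇒endpoints f-joins (x∉S , z∉S)) f-joins (F-walk-avoiding-S w z∉S y∉S)
    F-walk-avoiding-S-via f f∈F f-joins nil x∉S y∉S (yes y∈S) = ⊥-elim (y∉S y∈S)
    F-walk-avoiding-S-via {x} {z} {y} f f∈F f-joins (cons {b = t} g g∈F g-joins w) x∉S y∉S (yes z∈S) =
      subst (λ q → FS-Walk q y) t≡x (F-walk-avoiding-S w (subst (_∉ S) (sym t≡x) x∉S) y∉S)
      where
      z∉R : z ∉ R
      z∉R = ∈S⇒∉R z∈S
      f≡g : f ≡ g
      f≡g = trans (proj₂ (F-edge-outside-R z∉R (proj₂ (Joins-incident f-joins)) f∈F))
                  (sym (proj₂ (F-edge-outside-R z∉R (proj₁ (Joins-incident g-joins)) g∈F)))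
      t≡x : t ≡ x
      t≡x = Joins-backtrack f-joins (subst (λ h → Joins ends h z t) (sym f≡g) g-joins)
              (λ x≡z → x∉S (subst (_∈ₛ S) (sym x≡z) z∈S))

    -- A cycle of G \ S cannot stay inside the forest G[R]; at a vertex outside R it uses two
    -- distinct edges, at most one of which is e0.
    pair-edge-on-cycle : Acyclic ends (EdgesInside ends R) → (C : Cycle ends (EdgesAvoiding ends S)) →
      Σ (Fin (suc (Cycle.len C))) λ i → PairSet ends R L J (Cycle.es C i)
    pair-edge-on-cycle G[R]-acyclic C = pick (incident-label u∉R u∈es-j) (incident-label u∉R u∈es-next-j)
      where
      open Cycle C
      outside-R : Σ (Fin (suc len)) λ k → vs k ∉ R
      outside-R with all? (λ k → vs k ∈? R)
      ... | yes all∈R = ⊥-elim (G[R]-acyclic (record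
              { len = len ; vs = vs ; es = es ; vs-inj = vs-inj ; es-inj = es-inj ; joins = joins
              ; es-in = λ i → joined⇒endpoints {P = _∈ₛ R} (joins i) (all∈R i , all∈R (next i)) }))
      ... | no ¬all∈R = ¬∀⟶∃¬ (suc len) (λ k → vs k ∈ₛ R) (λ k → vs k ∈? R) ¬all∈R
      j : Fin (suc len)
      j = proj₁ (next-surjective (proj₁ outside-R))
      u : Fin n
      u = vs (next j)
      u∉R : u ∉ R
      u∉R = subst (λ k → vs k ∉ R) (sym (proj₂ (next-surjective (proj₁ outside-R)))) (proj₂ outside-R)
      u∈J : u ∈ₛ J
      u∈J = ∉S⇒∈J (proj₂ (endpoints⇒joined {P = _∉ S} (joins j) (es-in j))) u∉R
      u∈es-j : Incident ends (es j) u
      u∈es-j = proj₂ (Joins-incident (joins j))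
      u∈es-next-j : Incident ends (es (next j)) u
      u∈es-next-j = proj₁ (Joins-incident (joins (next j)))
      pick : (Tent ends R u × es j ≡ e0 u) ⊎ (es j ≡ e1 u ⊎ es j ≡ e2 u) →
             (Tent ends R u × es (next j) ≡ e0 u) ⊎ (es (next j) ≡ e1 u ⊎ es (next j) ≡ e2 u) →
             Σ (Fin (suc len)) λ i → PairSet ends R L J (es i)
      pick (inj₂ es-j∈pair) _ = j , u , u∈J , es-j∈pair
      pick (inj₁ _) (inj₂ es-next-j∈pair) = next j , u , u∈J , es-next-j∈pair
      pick (inj₁ (_ , es-j≡e0)) (inj₁ (_ , es-next-j≡e0)) =
        ⊥-elim (no-loop-outside-R (subst (λ k → Joins ends (es j) (vs k) u) j≡next-j (joins j)) u∉R)
        where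
        j≡next-j : j ≡ next j
        j≡next-j = es-inj (trans es-j≡e0 (sym es-next-j≡e0))

-- Independent pair sets are complements of feedback vertex sets

module _ {n m} (ends : Ends n m) (R : Subset n)
  (G[R]-acyclic : Acyclic ends (EdgesInside ends R))
  (nice-or-tent : ∀ v → v ∉ R → Nice ends R v ⊎ Tent ends R v)
  (L : Labelling ends R)
  (Fs : List (Fin m)) (Fs⇔F : ∀ e → (e ∈ Fs) ⇔ InF ends R L e) where

  open NiceTent ends R nice-or-tent L

  contraction : Contraction ends (InF ends R L) (contractAll ends Fs)
  contraction =
    Contraction-resp ends (Equivalence.to (Fs⇔F _)) (Equivalence.from (Fs⇔F _)) (contractAll-contraction ends Fs)

  open Contraction contraction using (ρ; connects; present)

  pairs-independent⇔FVS : ∀ {J} → J ⊆ ∁ R →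
    GraphicIndependent (contractAll ends Fs) (PairSet ends R L J) ⇔ IsFVS ends (∁ R ─ J)
  pairs-independent⇔FVS {J} J⊆∁R = mk⇔
    (λ (_ , acyclic) cycle →
       acyclic (project-cycle contraction (classify J) cycle (pair-edge-on-cycle J G[R]-acyclic cycle)))
    (λ fvs → (λ e pair-e → present e (pair-∉F′ pair-e)) ,
             λ cycle → fvs (lift-cycle contraction (_∉ S J) (pair-edge-kept J J⊆∁R) pair-∉F′ bridge cycle))
    where
    pair-∉F′ : ∀ {f} → PairSet ends R L J f → ¬ InF ends R L f
    pair-∉F′ (v , v∈J , f∈pair) = pair-∉F (x∈∁p⇒x∉p (J⊆∁R v∈J)) f∈pair
    bridge : ∀ {x y} → ρ x ≡ ρ y → x ∉ S J → y ∉ S J → FS-Walk J x y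
    bridge {x} {y} ρx≡ρy = F-walk-avoiding-S J (connects x y ρx≡ρy)

lemma5 : ∀ {n m} (ends : Ends n m) (w : Fin n → ℕ) (R : Subset n)
    → IsFVS ends R
    → Acyclic ends (EdgesInside ends R)
    → (∀ v → v ∉ R → Nice ends R v ⊎ Tent ends R v)
    → (L : Labelling ends R)
    → (Fs : List (Fin m)) → (∀ e → (e ∈ Fs) ⇔ InF ends R L e)
    → ∀ (I : Subset n) → I ⊆ ∁ R
    → MaxWeightIndep ends R L Fs w I ⇔ MinWeightFVS ends R L Fs w (∁ R ─ I)
-- G \ R is a forest anyway, since every edge has an endpoint in R.
lemma5 ends w R _ G[R]-acyclic nice-or-tent L Fs Fs⇔F I I⊆∁R =
  max-weight⇔min-weight-complement (∁ R) w
    (λ J → GraphicIndependent (contractAll ends Fs) (PairSet ends R L J)) (IsFVS ends)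
    (pairs-independent⇔FVS ends R G[R]-acyclic nice-or-tent L Fs Fs⇔F) I⊆∁R
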